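{- Let $G$ be a graph and $k,h$ positive integers. Suppose $(G,k,h)$ is a yes-instance of the $\mathcal{T}_{h+1}$-Free Edge Deletion problem and $G$ has no connected component with at most $h$ vertices. Then $|V(G)|\le 2kh$ and $|E(G)|\le 2kh^2+k$.
   Context: The $\mathcal{T}_{h+1}$-Free Edge Deletion problem: the input is a (simple, undirected) graph $G=(V,E)$ and two positive integers $k$ and $h$; the question is whether there exists $E'\subseteq E(G)$ with $|E'|=k$ such that every connected component of $G\setminus E'$ has at most $h$ vertices (equivalently, $G\setminus E'$ contains no tree on $h+1$ vertices as a subgraph). -}

module Defs where

open import Data.Nat using (ℕ; _<_; _≤_)
open import Data.Fin using (Fin; toℕ)
open import Data.Product using (_×_; _,_; Σ; proj₁; proj₂)
open import Data.Sum using (_⊎_)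
open import Data.List using (List; length; _++_)
open import Data.List.Relation.Unary.All using (All)
open import Data.List.Relation.Unary.Unique.Propositional using (Unique)
open import Data.List.Membership.Propositional using (_∈_)
open import Data.List.Relation.Binary.Permutation.Propositional using (_↭_)
open import Relation.Binary.Construct.Closure.ReflexiveTransitive using (Star)
open import Relation.Nullary using (¬_)
open import Relation.Binary.PropositionalEquality using (_≡_)

-- Each edge {u,v} is stored once as (u , v) with toℕ u < toℕ v (so no loops),
-- and the list has no duplicates (so no multi-edges).
record Graph : Set where
  field
    n       : ℕ
    edges   : List (Fin n × Fin n)
    ordered : All (λ e → toℕ (proj₁ e) < toℕ (proj₂ e)) edges
    simple  : Unique edges
open Graph public

∣V∣ : Graph → ℕ
∣V∣ G = n G

∣E∣ : Graph → ℕ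
∣E∣ G = length (edges G)

Adj : {m : ℕ} → List (Fin m × Fin m) → Fin m → Fin m → Set
Adj es u v = ((u , v) ∈ es) ⊎ ((v , u) ∈ es)

Reach : {m : ℕ} → List (Fin m × Fin m) → Fin m → Fin m → Set
Reach es = Star (Adj es)

ComponentAtMost : {m : ℕ} → List (Fin m × Fin m) → ℕ → Fin m → Set
ComponentAtMost {m} es h v =
  (xs : List (Fin m)) → Unique xs → All (Reach es v) xs → length xs ≤ h

AllComponentsAtMost : {m : ℕ} → List (Fin m × Fin m) → ℕ → Set
AllComponentsAtMost {m} es h = (v : Fin m) → ComponentAtMost es h v

-- (G, k, h) is a yes-instance of T_{h+1}-Free Edge Deletion: there is a set
-- E' ⊆ E(G) with |E'| = k such that every component of G ∖ E' has at most h
-- vertices.  Since E(G) is duplicate-free, a subset E' with remainder R is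
-- expressed as a splitting  E(G) ↭ E' ++ R ; G ∖ E' has edge list R.
YesInstance : Graph → ℕ → ℕ → Set
YesInstance G k h =
  Σ (List (Fin (n G) × Fin (n G))) λ E' →
  Σ (List (Fin (n G) × Fin (n G))) λ R →
    (edges G ↭ (E' ++ R)) × (length E' ≡ k) × AllComponentsAtMost R h

NoSmallComponent : Graph → ℕ → Set
NoSmallComponent G h = (v : Fin (n G)) → ¬ ComponentAtMost (edges G) h v

module Submission where

-- Let D be the k deleted edges and R the remaining ones. A component of G ∖ D that contains
-- no endpoint of D is a whole component of G, hence has more than h vertices; so every
-- component of G ∖ D contains one of the at most 2k endpoints of D. Each of these components
-- has at most h vertices and at most h² edges, whence |V| ≤ 2kh and |E| ≤ |D| + 2kh².
-- Reachability is not decided, so this covering argument runs under double negation, which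
-- the decidable conclusions then discharge.

open import Defs
open import Level using (0ℓ)
open import Data.Nat using (ℕ; _*_; _+_; _≤_; _>_; z≤n; _≤?_)
open import Data.Nat.Properties
  using (+-comm; +-identityʳ; +-mono-≤; +-monoˡ-≤; *-monoˡ-≤; module ≤-Reasoning)
open import Data.Product as Product using (_×_; _,_; proj₁; proj₂)
open import Function using (id; _∘′_)
open import Data.Sum as Sum using (_⊎_; inj₁; inj₂)
open import Data.Empty using (⊥-elim)
open import Data.Fin using (Fin; _≟_)
open import Data.List using (List; []; _∷_; length; _++_; map; allFin; deduplicate)
open import Data.List.Properties using (length-++; length-map; length-tabulate)
open import Data.List.Relation.Unary.All as All using (All; []; _∷_)
import Data.List.Relation.Unary.All.Properties as All
open import Data.List.Relation.Unary.Any as Any using (Any)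
open import Data.List.Relation.Unary.AllPairs using (_∷_)
open import Data.List.Relation.Unary.Unique.Propositional using (Unique; [])
open import Data.List.Relation.Unary.Unique.Propositional.Properties
  using (allFin⁺) renaming (map⁻ to Unique-map⁻)
import Data.List.Relation.Unary.Unique.DecPropositional.Properties as UniqueDec
open import Data.List.Membership.Propositional using (_∈_; lose)
open import Data.List.Membership.Propositional.Properties
  using (∈-map⁺; ∈-++⁺ˡ; ∈-++⁺ʳ; ∈-++⁻; ∈-deduplicate⁺)
open import Data.List.Relation.Binary.Permutation.Propositional
  using (_↭_; ↭-refl; ↭-sym; ↭-trans; ↭-prep; ↭⇒↭ₛ)
open import Data.List.Relation.Binary.Permutation.Propositional.Properties
  using (∈-resp-↭; ↭-length; shift)
import Data.List.Relation.Binary.Permutation.Setoid.Properties as PermutationSetoid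
open import Relation.Binary.Construct.Closure.ReflexiveTransitive as Star using (ε; _◅_; _◅◅_)
open import Relation.Binary.Definitions using (DecidableEquality)
open import Relation.Binary.PropositionalEquality
  using (_≡_; refl; sym; cong; cong₂; subst; setoid; module ≡-Reasoning)
open import Relation.Nullary using (¬_; Dec; yes; no)
open import Relation.Nullary.Decidable using (decidable-stable; ¬¬-excluded-middle)
open import Relation.Nullary.Negation using (¬¬-Monad; ¬¬-map)
open import Effect.Monad using (RawMonad)

open RawMonad (¬¬-Monad {a = 0ℓ}) using (pure; _<$>_; _<*>_; _>>=_)

private
  variable
    A : Set

Unique-resp-↭ : {xs ys : List A} → xs ↭ ys → Unique xs → Unique ys
Unique-resp-↭ p = PermutationSetoid.Unique-resp-↭ (setoid _) (↭⇒↭ₛ p)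

Unique-++⁻ : ∀ (xs : List A) {ys} → Unique (xs ++ ys) → Unique xs × Unique ys
Unique-++⁻ []       !ys         = [] , !ys
Unique-++⁻ (x ∷ xs) (x∉ ∷ !xys) = Product.map₁ (All.++⁻ˡ xs x∉ ∷_) (Unique-++⁻ xs !xys)

record Partition (P : A → Set) (xs : List A) : Set where
  constructor mkPartition
  field
    inside outside : List A
    all-inside     : All P inside
    none-outside   : All (¬_ ∘′ P) outside
    ↭xs            : inside ++ outside ↭ xs

Partition-∷ : {P : A → Set} {x : A} {xs : List A} →
              Dec (P x) → Partition P xs → Partition P (x ∷ xs)
Partition-∷ {x = x} (yes px) (mkPartition ys zs Pys ¬Pzs p) =
  mkPartition (x ∷ ys) zs (px ∷ Pys) ¬Pzs (↭-prep x p)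
Partition-∷ {x = x} (no ¬px) (mkPartition ys zs Pys ¬Pzs p) =
  mkPartition ys (x ∷ zs) Pys (¬px ∷ ¬Pzs) (↭-trans (shift x ys zs) (↭-prep x p))

partition-¬¬ : (P : A → Set) (xs : List A) → ¬ ¬ Partition P xs
partition-¬¬ P []       = pure (mkPartition [] [] [] [] ↭-refl)
partition-¬¬ P (x ∷ xs) = Partition-∷ <$> ¬¬-excluded-middle <*> partition-¬¬ P xs

module _ {X : Set} (C : X → A → Set) {B : ℕ}
         (bounded : ∀ x ys → Unique ys → All (C x) ys → length ys ≤ B) where

  private
    union-bound-¬¬ : ∀ L {as} → Unique as → All (λ a → ¬ ¬ Any (λ x → C x a) L) as →
                     ¬ ¬ (length as ≤ length L * B)
    union-bound-¬¬ []      {[]}    _   _               = pure z≤n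
    union-bound-¬¬ []      {_ ∷ _} _   (¬¬covered ∷ _) = ⊥-elim (¬¬covered λ ())
    union-bound-¬¬ (x ∷ L) {as}    !as covered         = do
      mkPartition ys zs Cys ¬Czs ys++zs↭as ← partition-¬¬ (C x) as
      let !ys , !zs = Unique-++⁻ ys (Unique-resp-↭ (↭-sym ys++zs↭as) !as)
          covered-zs = All.tabulate λ z∈zs →
            ¬¬-map (Any.tail (All.lookup ¬Czs z∈zs))
                   (All.lookup covered (∈-resp-↭ ys++zs↭as (∈-++⁺ʳ ys z∈zs)))
      zs-bound ← union-bound-¬¬ L !zs covered-zs
      pure (begin
        length as                 ≡⟨ sym (↭-length ys++zs↭as) ⟩
        length (ys ++ zs)         ≡⟨ length-++ ys ⟩
        length ys + length zs     ≤⟨ +-mono-≤ (bounded x ys !ys Cys) zs-bound ⟩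
        B + length L * B          ∎)
      where open ≤-Reasoning

  union-bound : ∀ L {as} → Unique as → All (λ a → ¬ ¬ Any (λ x → C x a) L) as →
                length as ≤ length L * B
  union-bound L !as covered = decidable-stable (_ ≤? _) (union-bound-¬¬ L !as covered)

map-pairing-proj₂ : {a : A} {ps : List (A × A)} →
                    All (λ p → proj₁ p ≡ a) ps → map (a ,_) (map proj₂ ps) ≡ ps
map-pairing-proj₂ []         = refl
map-pairing-proj₂ (refl ∷ q) = cong (_ ∷_) (map-pairing-proj₂ q)

square-bound : {A : Set} → DecidableEquality A → (P : A → Set) {h : ℕ} →
               (∀ xs → Unique xs → All P xs → length xs ≤ h) →
               ∀ {ps : List (A × A)} → Unique ps → All (λ p → P (proj₁ p) × P (proj₂ p)) ps →
               length ps ≤ h * h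
square-bound {A} _≟ᴬ_ P {h} bounded {ps} !ps Pps = begin
  length ps          ≤⟨ union-bound Row row-bound rows !ps (All.tabulate row-of) ⟩
  length rows * h    ≤⟨ *-monoˡ-≤ h (bounded rows (UniqueDec.deduplicate-! _≟ᴬ_ _) P-rows) ⟩
  h * h              ∎
  where
  open ≤-Reasoning

  rows : List A
  rows = deduplicate _≟ᴬ_ (map proj₁ ps)

  Row : A → A × A → Set
  Row a p = proj₁ p ≡ a × P (proj₂ p)

  row-bound : ∀ a qs → Unique qs → All (Row a) qs → length qs ≤ h
  row-bound a qs !qs Rqs = begin
    length qs             ≡⟨ sym (length-map proj₂ qs) ⟩
    length (map proj₂ qs) ≤⟨ bounded _ !proj₂qs (All.map⁺ (All.map proj₂ Rqs)) ⟩
    h                     ∎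
    where
    !proj₂qs : Unique (map proj₂ qs)
    !proj₂qs = Unique-map⁻ (subst Unique (sym (map-pairing-proj₂ (All.map proj₁ Rqs))) !qs)

  row-of : ∀ {p} → p ∈ ps → ¬ ¬ Any (λ a → Row a p) rows
  row-of p∈ps = pure (Any.map (_, proj₂ (All.lookup Pps p∈ps))
                              (∈-deduplicate⁺ _≟ᴬ_ (∈-map⁺ proj₁ p∈ps)))

  P-rows : All P rows
  P-rows = All.deduplicate⁺ _≟ᴬ_ (All.map⁺ (All.map proj₁ Pps))

endpoints : List (A × A) → List A
endpoints es = map proj₁ es ++ map proj₂ es

length-endpoints : (es : List (A × A)) → length (endpoints es) ≡ 2 * length es
length-endpoints es = begin
  length (map proj₁ es ++ map proj₂ es)          ≡⟨ length-++ (map proj₁ es) ⟩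
  length (map proj₁ es) + length (map proj₂ es)  ≡⟨ cong₂ _+_ (length-map proj₁ es) (length-map proj₂ es) ⟩
  length es + length es                          ≡⟨ cong (length es +_) (sym (+-identityʳ _)) ⟩
  2 * length es                                  ∎
  where open ≡-Reasoning

module _ {m : ℕ} {es : List (Fin m × Fin m)} where

  Adj-sym : ∀ {a b} → Adj es a b → Adj es b a
  Adj-sym (inj₁ ab∈es) = inj₂ ab∈es
  Adj-sym (inj₂ ba∈es) = inj₁ ba∈es

  Reach-sym : ∀ {a b} → Reach es a b → Reach es b a
  Reach-sym = Star.reverse Adj-sym

  Adj⇒∈endpoints : ∀ {a b} → Adj es a b → a ∈ endpoints es
  Adj⇒∈endpoints (inj₁ ab∈es) = ∈-++⁺ˡ (∈-map⁺ proj₁ ab∈es)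
  Adj⇒∈endpoints (inj₂ ba∈es) = ∈-++⁺ʳ (map proj₁ es) (∈-map⁺ proj₂ ba∈es)

module Deletion {m h : ℕ} {E D R : List (Fin m × Fin m)} (E↭D++R : E ↭ D ++ R)
                (!E : Unique E) (small : AllComponentsAtMost R h)
                (large : ∀ v → ¬ ComponentAtMost E h v) where

  Adj-split : ∀ {a b} → Adj E a b → Adj D a b ⊎ Adj R a b
  Adj-split (inj₁ ab∈E) = Sum.map inj₁ inj₁ (∈-++⁻ D (∈-resp-↭ E↭D++R ab∈E))
  Adj-split (inj₂ ba∈E) = Sum.map inj₂ inj₂ (∈-++⁻ D (∈-resp-↭ E↭D++R ba∈E))

  Reach-avoiding : ∀ {w v} → ¬ Any (λ x → Reach R x w) (endpoints D) → Reach E w v → Reach R w v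
  Reach-avoiding {w} unreached = extend ε
    where
    extend : ∀ {a v} → Reach R w a → Reach E a v → Reach R w v
    extend w⇝a ε = w⇝a
    extend w⇝a (a~b ◅ b⇝v) with Adj-split a~b
    ... | inj₁ a~ᴰb = ⊥-elim (unreached (lose (Adj⇒∈endpoints a~ᴰb) (Reach-sym w⇝a)))
    ... | inj₂ a~ᴿb = extend (w⇝a ◅◅ a~ᴿb ◅ ε) b⇝v

  reached-from-endpoint : ∀ v → ¬ ¬ Any (λ x → Reach R x v) (endpoints D)
  reached-from-endpoint v unreached =
    large v λ xs !xs E-reach → small v xs !xs (All.map (Reach-avoiding unreached) E-reach)

  vertex-count : m ≤ 2 * length D * h
  vertex-count = begin
    m                          ≡⟨ sym (length-tabulate id) ⟩
    length (allFin m)          ≤⟨ union-bound (Reach R) small (endpoints D) (allFin⁺ m)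
                                    (All.tabulate λ {v} _ → reached-from-endpoint v) ⟩
    length (endpoints D) * h   ≡⟨ cong (_* h) (length-endpoints D) ⟩
    2 * length D * h           ∎
    where open ≤-Reasoning

  edge-count : length E ≤ 2 * length D * (h * h) + length D
  edge-count = begin
    length E                                ≡⟨ ↭-length E↭D++R ⟩
    length (D ++ R)                         ≡⟨ length-++ D ⟩
    length D + length R                     ≡⟨ +-comm (length D) _ ⟩
    length R + length D                     ≤⟨ +-monoˡ-≤ _ R-count ⟩
    2 * length D * (h * h) + length D       ∎
    where
    open ≤-Reasoning

    InComponent : Fin m → Fin m × Fin m → Set
    InComponent x e = Reach R x (proj₁ e) × Reach R x (proj₂ e)

    edge-reached : ∀ {e} → e ∈ R → ¬ ¬ Any (λ x → InComponent x e) (endpoints D)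
    edge-reached e∈R = Any.map (λ x⇝u → x⇝u , x⇝u ◅◅ inj₁ e∈R ◅ ε) <$> reached-from-endpoint _

    R-count : length R ≤ 2 * length D * (h * h)
    R-count = begin
      length R                         ≤⟨ union-bound InComponent
                                            (λ x _ → square-bound _≟_ (Reach R x) (small x))
                                            (endpoints D) !R (All.tabulate edge-reached) ⟩
      length (endpoints D) * (h * h)   ≡⟨ cong (_* (h * h)) (length-endpoints D) ⟩
      2 * length D * (h * h)           ∎
      where
      !R : Unique R
      !R = proj₂ (Unique-++⁻ D (Unique-resp-↭ E↭D++R !E))

lemma2 : (G : Graph) (k h : ℕ) → k > 0 → h > 0 →
         YesInstance G k h → NoSmallComponent G h →
         (∣V∣ G ≤ 2 * k * h) × (∣E∣ G ≤ 2 * k * (h * h) + k)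
lemma2 G _ h _ _ (D , R , E↭D++R , refl , small) large = vertex-count , edge-count
  where open Deletion {D = D} E↭D++R (simple G) small large
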